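{- Let $a\in\mathbb{Q}$, $c=-a-a^2$, $f(x)=x^2+c$. Write $a=\frac{r}{s}$ with $r,s\in\mathbb{Z}$, $\gcd(r,s)=1$, $s>0$, and for $n\ge0$ write $f^n(0)-a=\frac{r_n}{s_n}$ with $r_n,s_n\in\mathbb{Z}$, $\gcd(r_n,s_n)=1$, $s_n>0$. If $r\not\equiv0\pmod 3$, then $r_n\equiv1\pmod3$ for all $n\ge2$.
   Context: $f^n$ denotes the $n$-th iterate of $f$. -}

module Defs where

open import Data.Nat using (ℕ; zero; suc)
open import Data.Rational using (ℚ; 0ℚ; _+_; _*_; -_)

iter : (ℚ → ℚ) → ℕ → ℚ → ℚ
iter f zero x = x
iter f (suc n) x = f (iter f n x)

cOf : ℚ → ℚ
cOf a = - a + - (a * a)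

fOf : ℚ → ℚ → ℚ
fOf a x = x * x + cOf a

{-# OPTIONS --safe #-}

-- Write a = r/s in lowest terms and κ = -(rs + r²), so that c = κ/s². With t₀ = 1,
-- t_{m+1} = s t_m², num₀ = κ and num_{m+1} = num_m² + κ t_{m+1}², induction gives
-- f^{m+1}(0) = num_m / (s t_m)² with num_m coprime to s t_m, so the reduced numerator of
-- f^{m+1}(0) - a is num_m - r t_{m+1}. Modulo 3, x³ ≡ x gives t_{m+1} ≡ s, and r² ≡ 1
-- gives num_m² ≡ (rs + 1)², hence num_{m+1} ≡ (rs + 1)² - (rs + r²) s² ≡ rs + 1 and the
-- numerator of f^{m+2}(0) - a is ≡ rs + 1 - rs = 1. No case split on 3 ∣ s is needed.

module Submission where

open import Defs
open import Data.Nat using (ℕ; _≥_)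
open import Data.Integer using (ℤ; +_; _-_)
open import Data.Integer.Divisibility using (_∣_)
open import Data.Rational using (ℚ; ↥_; 0ℚ) renaming (_-_ to _-ℚ_)
open import Relation.Nullary using (¬_)

open import Data.Nat using (zero; suc; s≤s)
import Data.Nat as ℕ
import Data.Nat.Divisibility as ℕ
open import Data.Nat.Coprimality using (Coprime; coprime-Bézout; recompute)
open import Data.Nat.GCD using (module Bézout)
open import Data.Integer using (_+_; _*_; -_; 0ℤ; 1ℤ; -1ℤ; +[1+_]; -[1+_]; ∣_∣; NonZero)
import Data.Integer.Properties as ℤ
import Data.Integer.DivMod as ℤ
open import Data.Integer.GCD using (gcd)
import Data.Integer.Divisibility.Signed as Signed
open import Data.Integer.Tactic.RingSolver using (solve)
open import Data.List using (_∷_; [])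
import Data.Rational as ℚ
open import Data.Rational using (mkℚ; ↧_; ↧ₙ_)
import Data.Rational.Properties as ℚ
import Data.Rational.Unnormalised as ℚᵘ
open import Data.Product using (∃₂; _,_)
open import Data.Sum using (_⊎_; inj₁; inj₂)
open import Data.Empty using (⊥-elim)
open import Function using (_∘_)
open import Relation.Binary.Bundles using (Setoid)
import Relation.Binary.Reasoning.Setoid
open import Relation.Binary.PropositionalEquality
  using (_≡_; refl; sym; trans; cong; cong₂; subst; subst₂; module ≡-Reasoning)
open import Algebra.Properties.CommutativeSemigroup ℤ.*-commutativeSemigroup
  using (x∙yz≈xz∙y)

Comaximal : ℤ → ℤ → Set
Comaximal a b = ∃₂ λ u v → u * a + v * b ≡ 1ℤ

comaximal-sym : ∀ {a b} → Comaximal a b → Comaximal b a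
comaximal-sym {a} {b} (u , v , eq) = v , u , trans (ℤ.+-comm (v * b) (u * a)) eq

comaximal-+* : ∀ {a b} k → Comaximal a b → Comaximal (a + k * b) b
comaximal-+* {a} {b} k (u , v , eq) = u , v - u * k , (begin
  u * (a + k * b) + (v - u * k) * b ≡⟨ solve (u ∷ v ∷ a ∷ b ∷ k ∷ []) ⟩
  u * a + v * b                     ≡⟨ eq ⟩
  1ℤ                                ∎)
  where open ≡-Reasoning

comaximal-neg : ∀ {a b} → Comaximal a b → Comaximal (- a) b
comaximal-neg {a} {b} (u , v , eq) = - u , v , (begin
  - u * - a + v * b ≡⟨ solve (u ∷ v ∷ a ∷ b ∷ []) ⟩
  u * a + v * b     ≡⟨ eq ⟩
  1ℤ                ∎)
  where open ≡-Reasoning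

comaximal-*ˡ : ∀ {a b c} → Comaximal a c → Comaximal b c → Comaximal (a * b) c
comaximal-*ˡ {a} {b} {c} (u , v , eq) (u′ , v′ , eq′) =
  u * u′ , u * a * v′ + v * u′ * b + v * v′ * c , (begin
  u * u′ * (a * b) + (u * a * v′ + v * u′ * b + v * v′ * c) * c
    ≡⟨ solve (u ∷ v ∷ u′ ∷ v′ ∷ a ∷ b ∷ c ∷ []) ⟩
  (u * a + v * c) * (u′ * b + v′ * c)
    ≡⟨ cong₂ _*_ eq eq′ ⟩
  1ℤ ∎)
  where open ≡-Reasoning

comaximal-*ʳ : ∀ {a b c} → Comaximal a b → Comaximal a c → Comaximal a (b * c)
comaximal-*ʳ a⊥b a⊥c = comaximal-sym (comaximal-*ˡ (comaximal-sym a⊥b) (comaximal-sym a⊥c))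

comaximal-difference : ∀ {a b} x y → 1ℤ + y * b ≡ x * a → Comaximal a b
comaximal-difference {a} {b} x y eq = x , - y , (begin
  x * a + - y * b            ≡⟨ cong (_+ - y * b) eq ⟨
  1ℤ + y * b + - y * b       ≡⟨ solve (y ∷ b ∷ []) ⟩
  1ℤ                         ∎)
  where open ≡-Reasoning

comaximal⇒coprime : ∀ {a b} → Comaximal a b → Coprime ∣ a ∣ ∣ b ∣
comaximal⇒coprime (u , v , eq) {k} (k∣a , k∣b) = ℕ.∣1⇒≡1 (Signed.∣⇒∣ᵤ k∣1)
  where
  k∣1 : + k Signed.∣ 1ℤ
  k∣1 = subst (+ k Signed.∣_) eq
    (Signed.∣m∣n⇒∣m+n (Signed.∣n⇒∣m*n u (Signed.∣ᵤ⇒∣ k∣a))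
                       (Signed.∣n⇒∣m*n v (Signed.∣ᵤ⇒∣ k∣b)))

comaximal-difference-ℕ : ∀ {m n} x y → 1 ℕ.+ y ℕ.* n ≡ x ℕ.* m → Comaximal (+ m) (+ n)
comaximal-difference-ℕ {m} {n} x y eq = comaximal-difference (+ x) (+ y)
  (trans (cong (_+_ 1ℤ) (sym (ℤ.pos-* y n))) (trans (cong +_ eq) (ℤ.pos-* x m)))

bézout⇒comaximal : ∀ {m n} → Bézout.Identity 1 m n → Comaximal (+ m) (+ n)
bézout⇒comaximal (Bézout.+- x y eq) = comaximal-difference-ℕ x y eq
bézout⇒comaximal (Bézout.-+ x y eq) = comaximal-sym (comaximal-difference-ℕ y x eq)

coprime⇒comaximal : ∀ a n → Coprime ∣ a ∣ n → Comaximal a (+ n)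
coprime⇒comaximal (+ m)    n c = bézout⇒comaximal (coprime-Bézout c)
coprime⇒comaximal -[1+ m ] n c = comaximal-neg (bézout⇒comaximal (coprime-Bézout c))

comaximal-↥↧ : ∀ q → Comaximal (↥ q) (↧ q)
comaximal-↥↧ (mkℚ n d c) = coprime⇒comaximal n (suc d) (recompute c)

-- These relations (and _≈_ below) are data types rather than definitions so that their
-- indices stay inferable: ℤ multiplication unfolds during unification.

infix 4 _÷_≋_÷_

data _÷_≋_÷_ (a b n d : ℤ) : Set where
  *≡* : a * d ≡ n * b → a ÷ b ≋ n ÷ d

≋-trans : ∀ {a b n d n′ d′} .{{_ : NonZero d}} →
          a ÷ b ≋ n ÷ d → n ÷ d ≋ n′ ÷ d′ → a ÷ b ≋ n′ ÷ d′
≋-trans {a} {b} {n} {d} {n′} {d′} (*≡* ad≡nb) (*≡* nd′≡n′d) = *≡* (ℤ.*-cancelʳ-≡ _ _ d (begin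
  a * d′ * d   ≡⟨ solve (a ∷ d ∷ d′ ∷ []) ⟩
  a * d * d′   ≡⟨ cong (_* d′) ad≡nb ⟩
  n * b * d′   ≡⟨ solve (n ∷ b ∷ d′ ∷ []) ⟩
  n * d′ * b   ≡⟨ cong (_* b) nd′≡n′d ⟩
  n′ * d * b   ≡⟨ solve (n′ ∷ b ∷ d ∷ []) ⟩
  n′ * b * d   ∎))
  where open ≡-Reasoning

≋-cancel : ∀ {a b n d} k .{{_ : NonZero k}} → a ÷ b ≋ n * k ÷ d * k → a ÷ b ≋ n ÷ d
≋-cancel {a} {b} {n} {d} k (*≡* adk≡nkb) = *≡* (ℤ.*-cancelʳ-≡ _ _ k (begin
  a * d * k     ≡⟨ solve (a ∷ d ∷ k ∷ []) ⟩
  a * (d * k)   ≡⟨ adk≡nkb ⟩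
  n * k * b     ≡⟨ solve (n ∷ k ∷ b ∷ []) ⟩
  n * b * k     ∎))
  where open ≡-Reasoning

≋-neg : ∀ {a b n d} → a ÷ b ≋ n ÷ d → - a ÷ b ≋ - n ÷ d
≋-neg {a} {b} {n} {d} (*≡* ad≡nb) = *≡* (begin
  - a * d     ≡⟨ solve (a ∷ d ∷ []) ⟩
  - (a * d)   ≡⟨ cong -_ ad≡nb ⟩
  - (n * b)   ≡⟨ solve (n ∷ b ∷ []) ⟩
  - n * b     ∎)
  where open ≡-Reasoning

module _ {a b c d n₁ d₁ n₂ d₂ : ℤ} where
  open ≡-Reasoning

  ≋-+ : a ÷ b ≋ n₁ ÷ d₁ → c ÷ d ≋ n₂ ÷ d₂ →
        a * d + c * b ÷ b * d ≋ n₁ * d₂ + n₂ * d₁ ÷ d₁ * d₂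
  ≋-+ (*≡* ad₁≡n₁b) (*≡* cd₂≡n₂d) = *≡* (begin
    (a * d + c * b) * (d₁ * d₂)
      ≡⟨ solve (a ∷ b ∷ c ∷ d ∷ d₁ ∷ d₂ ∷ []) ⟩
    (a * d₁) * (d * d₂) + (c * d₂) * (b * d₁)
      ≡⟨ cong₂ (λ x y → x * (d * d₂) + y * (b * d₁)) ad₁≡n₁b cd₂≡n₂d ⟩
    (n₁ * b) * (d * d₂) + (n₂ * d) * (b * d₁)
      ≡⟨ solve (b ∷ d ∷ n₁ ∷ n₂ ∷ d₁ ∷ d₂ ∷ []) ⟩
    (n₁ * d₂ + n₂ * d₁) * (b * d) ∎)

  ≋-* : a ÷ b ≋ n₁ ÷ d₁ → c ÷ d ≋ n₂ ÷ d₂ → a * c ÷ b * d ≋ n₁ * n₂ ÷ d₁ * d₂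
  ≋-* (*≡* ad₁≡n₁b) (*≡* cd₂≡n₂d) = *≡* (begin
    (a * c) * (d₁ * d₂)     ≡⟨ solve (a ∷ c ∷ d₁ ∷ d₂ ∷ []) ⟩
    (a * d₁) * (c * d₂)     ≡⟨ cong₂ _*_ ad₁≡n₁b cd₂≡n₂d ⟩
    (n₁ * b) * (n₂ * d)     ≡⟨ solve (b ∷ d ∷ n₁ ∷ n₂ ∷ []) ⟩
    (n₁ * n₂) * (b * d)     ∎)

infix 4 _≃_÷_

data _≃_÷_ (q : ℚ) (n d : ℤ) : Set where
  fraction : ↥ q ÷ ↧ q ≋ n ÷ d → q ≃ n ÷ d

≃÷-resp : ∀ {q n d n′ d′} → q ≃ n ÷ d → n ≡ n′ → d ≡ d′ → q ≃ n′ ÷ d′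
≃÷-resp q≃n/d refl refl = q≃n/d

≃÷-trans : ∀ {q n d n′ d′} .{{_ : NonZero d}} →
           q ≃ n ÷ d → n ÷ d ≋ n′ ÷ d′ → q ≃ n′ ÷ d′
≃÷-trans (fraction q≋) n/d≋n′/d′ = fraction (≋-trans q≋ n/d≋n′/d′)

≃÷-cancel : ∀ {q n d} k .{{_ : NonZero k}} → q ≃ n * k ÷ d * k → q ≃ n ÷ d
≃÷-cancel k (fraction q≋) = fraction (≋-cancel k q≋)

≃÷-/ : ∀ i n .{{_ : ℕ.NonZero n}} → i ℚ./ n ≃ i ÷ + n
≃÷-/ i n = fraction (*≡* (begin
  ↥ q * + n        ≡⟨ cong (↥ q *_) (ℚ.↧-/ i n) ⟨
  ↥ q * (↧ q * g)  ≡⟨ x∙yz≈xz∙y (↥ q) (↧ q) g ⟩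
  ↥ q * g * ↧ q    ≡⟨ cong (_* ↧ q) (ℚ.↥-/ i n) ⟩
  i * ↧ q          ∎))
  where
  open ≡-Reasoning
  q : ℚ
  q = i ℚ./ n
  g : ℤ
  g = gcd i (+ n)

+-≃÷ : ∀ p q → p ℚ.+ q ≃ ↥ p * ↧ q + ↥ q * ↧ p ÷ ↧ p * ↧ q
+-≃÷ p@record{} q@record{} =
  subst (p ℚ.+ q ≃ ↥ p * ↧ q + ↥ q * ↧ p ÷_) (ℤ.pos-* (↧ₙ p) (↧ₙ q))
    (≃÷-/ (↥ p * ↧ q + ↥ q * ↧ p) (↧ₙ p ℕ.* ↧ₙ q))

*-≃÷ : ∀ p q → p ℚ.* q ≃ ↥ p * ↥ q ÷ ↧ p * ↧ q
*-≃÷ p@record{} q@record{} =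
  subst (p ℚ.* q ≃ ↥ p * ↥ q ÷_) (ℤ.pos-* (↧ₙ p) (↧ₙ q))
    (≃÷-/ (↥ p * ↥ q) (↧ₙ p ℕ.* ↧ₙ q))

≃÷-+ : ∀ {p q n₁ d₁ n₂ d₂} → p ≃ n₁ ÷ d₁ → q ≃ n₂ ÷ d₂ →
       p ℚ.+ q ≃ n₁ * d₂ + n₂ * d₁ ÷ d₁ * d₂
≃÷-+ {p} {q} (fraction p≋) (fraction q≋) = ≃÷-trans (+-≃÷ p q) (≋-+ p≋ q≋)

≃÷-* : ∀ {p q n₁ d₁ n₂ d₂} → p ≃ n₁ ÷ d₁ → q ≃ n₂ ÷ d₂ →
       p ℚ.* q ≃ n₁ * n₂ ÷ d₁ * d₂
≃÷-* {p} {q} (fraction p≋) (fraction q≋) = ≃÷-trans (*-≃÷ p q) (≋-* p≋ q≋)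

≃÷-neg : ∀ {p n d} → p ≃ n ÷ d → ℚ.- p ≃ - n ÷ d
≃÷-neg {p} {n} {d} (fraction p≋) =
  fraction (subst₂ (λ a b → a ÷ b ≋ - n ÷ d) (sym (ℚ.↥-neg p)) (sym (ℚ.↧-neg p)) (≋-neg p≋))

↥-of-reduced : ∀ {q n d} → q ≃ n ÷ +[1+ d ] → Comaximal n +[1+ d ] → ↥ q ≡ n
↥-of-reduced {q@record{}} {n} {d} (fraction (*≡* q≃)) n⊥d =
  cong ↥_ (ℚ.toℚᵘ-injective {x = q} {y = mkℚ n d (comaximal⇒coprime n⊥d)} (ℚᵘ.*≡* q≃))

↥-unique : ∀ {q n} e .{{_ : NonZero e}} → q ≃ n ÷ e * e → Comaximal n e → ↥ q ≡ n
↥-unique +[1+ k ] q≃ n⊥e = ↥-of-reduced q≃ (comaximal-*ʳ n⊥e n⊥e)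
↥-unique -[1+ k ] q≃ n⊥e = ↥-of-reduced q≃ (comaximal-*ʳ n⊥e n⊥e)

module Congruence (m : ℤ) where

  infix 4 _≈_

  data _≈_ (x y : ℤ) : Set where
    ∣⇒≈ : m Signed.∣ x - y → x ≈ y

  ≈⇒∣ : ∀ {x y} → x ≈ y → m Signed.∣ x - y
  ≈⇒∣ (∣⇒≈ m∣x-y) = m∣x-y

  ∣-resp : ∀ {a b} → m Signed.∣ a → a ≡ b → m Signed.∣ b
  ∣-resp m∣a refl = m∣a

  ≈-refl : ∀ {x} → x ≈ x
  ≈-refl {x} = ∣⇒≈ (Signed.divides 0ℤ (ℤ.+-inverseʳ x))

  ≈-reflexive : ∀ {x y} → x ≡ y → x ≈ y
  ≈-reflexive refl = ≈-refl

  ≈-sym : ∀ {x y} → x ≈ y → y ≈ x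
  ≈-sym {x} {y} (∣⇒≈ m∣x-y) = ∣⇒≈ (∣-resp (Signed.∣m⇒∣-m m∣x-y) (solve (x ∷ y ∷ [])))

  ≈-trans : ∀ {x y z} → x ≈ y → y ≈ z → x ≈ z
  ≈-trans {x} {y} {z} (∣⇒≈ m∣x-y) (∣⇒≈ m∣y-z) =
    ∣⇒≈ (∣-resp (Signed.∣m∣n⇒∣m+n m∣x-y m∣y-z) (ℤ.+-minus-telescope x y z))

  +-cong : ∀ {x x′ y y′} → x ≈ x′ → y ≈ y′ → x + y ≈ x′ + y′
  +-cong {x} {x′} {y} {y′} (∣⇒≈ m∣x-x′) (∣⇒≈ m∣y-y′) =
    ∣⇒≈ (∣-resp (Signed.∣m∣n⇒∣m+n m∣x-x′ m∣y-y′) (solve (x ∷ x′ ∷ y ∷ y′ ∷ [])))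

  *-cong : ∀ {x x′ y y′} → x ≈ x′ → y ≈ y′ → x * y ≈ x′ * y′
  *-cong {x} {x′} {y} {y′} (∣⇒≈ m∣x-x′) (∣⇒≈ m∣y-y′) =
    ∣⇒≈ (∣-resp (Signed.∣m∣n⇒∣m+n (Signed.∣m⇒∣m*n y m∣x-x′) (Signed.∣n⇒∣m*n x′ m∣y-y′))
                (solve (x ∷ x′ ∷ y ∷ y′ ∷ [])))

  neg-cong : ∀ {x x′} → x ≈ x′ → - x ≈ - x′
  neg-cong {x} {x′} (∣⇒≈ m∣x-x′) =
    ∣⇒≈ (∣-resp (Signed.∣m⇒∣-m m∣x-x′) (solve (x ∷ x′ ∷ [])))

  ≈-by-division : ∀ {x r} q → x ≡ r + q * m → x ≈ r
  ≈-by-division {r = r} q refl = ∣⇒≈ (Signed.divides q (solve (r ∷ q ∷ m ∷ [])))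

  ≈-setoid : Setoid _ _
  ≈-setoid = record
    { Carrier = ℤ
    ; _≈_ = _≈_
    ; isEquivalence = record { refl = ≈-refl ; sym = ≈-sym ; trans = ≈-trans }
    }

  module ≈-Reasoning = Relation.Binary.Reasoning.Setoid ≈-setoid

open Congruence (+ 3)

residue-mod-3 : ∀ x → x ≈ 0ℤ ⊎ x ≈ 1ℤ ⊎ x ≈ -1ℤ
residue-mod-3 x with x ℤ.% + 3 | x ℤ./ + 3 | ℤ.n%d<d x (+ 3) | ℤ.a≡a%n+[a/n]*n x (+ 3)
... | 0 | q | _ | x≡0+3q = inj₁ (≈-by-division q x≡0+3q)
... | 1 | q | _ | x≡1+3q = inj₂ (inj₁ (≈-by-division q x≡1+3q))
... | 2 | q | _ | x≡2+3q =
  inj₂ (inj₂ (≈-trans {y = + 2} (≈-by-division q x≡2+3q) (∣⇒≈ (Signed.divides 1ℤ refl))))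
... | suc (suc (suc _)) | _ | s≤s (s≤s (s≤s ())) | _

cube≈ : ∀ x → x * (x * x) ≈ x
cube≈ x with residue-mod-3 x
... | inj₁ x≈0         = ≈-trans (*-cong x≈0 (*-cong x≈0 x≈0)) (≈-sym x≈0)
... | inj₂ (inj₁ x≈1)  = ≈-trans (*-cong x≈1 (*-cong x≈1 x≈1)) (≈-sym x≈1)
... | inj₂ (inj₂ x≈-1) = ≈-trans (*-cong x≈-1 (*-cong x≈-1 x≈-1)) (≈-sym x≈-1)

square≈1 : ∀ x → ¬ + 3 Signed.∣ x → x * x ≈ 1ℤ
square≈1 x 3∤x with residue-mod-3 x
... | inj₁ (∣⇒≈ 3∣x-0) = ⊥-elim (3∤x (∣-resp 3∣x-0 (ℤ.+-identityʳ x)))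
... | inj₂ (inj₁ x≈1)  = *-cong x≈1 x≈1
... | inj₂ (inj₂ x≈-1) = *-cong x≈-1 x≈-1

module Orbit (s κ : ℤ) where

  t : ℕ → ℤ
  t zero    = 1ℤ
  t (suc m) = s * (t m * t m)

  num : ℕ → ℤ
  num zero    = κ
  num (suc m) = num m * num m + κ * (t (suc m) * t (suc m))

  comaximal-num : Comaximal κ s → ∀ m → Comaximal (num m) (s * t m)
  comaximal-num κ⊥s zero    = subst (Comaximal κ) (sym (ℤ.*-identityʳ s)) κ⊥s
  comaximal-num κ⊥s (suc m) =
    subst₂ Comaximal (regroup (num m) (t m)) (square (t m)) (comaximal-+* (κ * (t m * t m)) n²⊥e²)
    where
    n⊥e : Comaximal (num m) (s * t m)
    n⊥e = comaximal-num κ⊥s m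
    n²⊥e² : Comaximal (num m * num m) ((s * t m) * (s * t m))
    n²⊥e² = comaximal-*ˡ (comaximal-*ʳ n⊥e n⊥e) (comaximal-*ʳ n⊥e n⊥e)
    regroup : ∀ n u → n * n + κ * (u * u) * ((s * u) * (s * u))
                    ≡ n * n + κ * ((s * (u * u)) * (s * (u * u)))
    regroup n u = solve (n ∷ u ∷ s ∷ κ ∷ [])
    square : ∀ u → (s * u) * (s * u) ≡ s * (s * (u * u))
    square u = solve (u ∷ s ∷ [])

  module _ .{{s≢0 : NonZero s}} where

    t-nonZero : ∀ m → NonZero (t m)
    t-nonZero zero    = _
    t-nonZero (suc m) =
      ℤ.i*j≢0 s (t m * t m) {{s≢0}} {{ℤ.i*j≢0 (t m) (t m) {{t-nonZero m}} {{t-nonZero m}}}}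

    module _ {c : ℚ} (c≃ : c ≃ κ ÷ s * s) where

      f : ℚ → ℚ
      f q = q ℚ.* q ℚ.+ c

      f-step : ∀ {q n} u → q ≃ n ÷ (s * u) * (s * u) →
               f q ≃ n * n + κ * ((s * (u * u)) * (s * (u * u))) ÷ (s * (s * (u * u))) * (s * (s * (u * u)))
      f-step {n = n} u q≃ = ≃÷-cancel (s * s) {{ℤ.i*j≢0 s s}}
        (≃÷-resp (≃÷-+ (≃÷-* q≃ q≃) c≃) (solve (n ∷ u ∷ s ∷ κ ∷ [])) (solve (u ∷ s ∷ [])))

      orbit≃ : ∀ m → iter f (suc m) 0ℚ ≃ num m ÷ (s * t m) * (s * t m)
      orbit≃ zero    = ≃÷-resp (≃÷-+ (≃÷-* 0≃ 0≃) c≃) numerator denominator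
        where
        0≃ : 0ℚ ≃ 0ℤ ÷ 1ℤ
        0≃ = fraction (*≡* refl)
        numerator : 0ℤ * 0ℤ * (s * s) + κ * (1ℤ * 1ℤ) ≡ κ
        numerator = solve (s ∷ κ ∷ [])
        denominator : 1ℤ * 1ℤ * (s * s) ≡ (s * 1ℤ) * (s * 1ℤ)
        denominator = solve (s ∷ [])
      orbit≃ (suc m) = f-step (t m) (orbit≃ m)

      minus-step : ∀ {q n b r} u → q ≃ n ÷ (s * u) * (s * u) → b ≃ r ÷ s →
                   q -ℚ b ≃ n - r * (s * (u * u)) ÷ (s * u) * (s * u)
      minus-step {n = n} {r = r} u q≃ b≃ =
        ≃÷-cancel s (≃÷-resp (≃÷-+ q≃ (≃÷-neg b≃)) (solve (n ∷ r ∷ u ∷ s ∷ [])) refl)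

      ↥-orbit-minus : ∀ {b r} → b ≃ r ÷ s → Comaximal κ s → ∀ m →
                      ↥ (iter f (suc m) 0ℚ -ℚ b) ≡ num m - r * t (suc m)
      ↥-orbit-minus {r = r} b≃ κ⊥s m =
        ↥-unique (s * t m) {{ℤ.i*j≢0 s (t m) {{s≢0}} {{t-nonZero m}}}} (minus-step (t m) (orbit≃ m) b≃)
          (subst (λ x → Comaximal x (s * t m)) (shift (num m) (t m))
            (comaximal-+* (- (r * t m)) (comaximal-num κ⊥s m)))
        where
        shift : ∀ n u → n + - (r * u) * (s * u) ≡ n - r * (s * (u * u))
        shift n u = solve (n ∷ r ∷ u ∷ s ∷ [])

cOf-≃÷ : ∀ {a r s} .{{_ : NonZero s}} → a ≃ r ÷ s → cOf a ≃ - (r * s + r * r) ÷ s * s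
cOf-≃÷ {r = r} {s} a≃ = ≃÷-cancel s (≃÷-resp (≃÷-+ (≃÷-neg a≃) (≃÷-neg (≃÷-* a≃ a≃)))
  (solve (r ∷ s ∷ [])) (solve (s ∷ [])))

comaximal-cOf-numerator : ∀ {r s} → Comaximal r s → Comaximal (- (r * s + r * r)) s
comaximal-cOf-numerator {r} {s} r⊥s =
  subst (λ x → Comaximal x s) expand (comaximal-neg (comaximal-*ˡ r⊥s (comaximal-+* 1ℤ r⊥s)))
  where
  expand : - (r * (r + 1ℤ * s)) ≡ - (r * s + r * r)
  expand = solve (r ∷ s ∷ [])

module _ (r s : ℤ) where
  open Orbit s (- (r * s + r * r))

  t-suc≈s : ∀ m → t (suc m) ≈ s
  t-suc≈s zero    = ≈-reflexive (ℤ.*-identityʳ s)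
  t-suc≈s (suc m) = ≈-trans (*-cong (≈-refl {s}) (*-cong (t-suc≈s m) (t-suc≈s m))) (cube≈ s)

  module _ (3∤r : ¬ + 3 Signed.∣ r) where
    open ≈-Reasoning

    num²≈ : ∀ m → num m * num m ≈ (r * s + 1ℤ) * (r * s + 1ℤ)
    num-suc≈ : ∀ m → num (suc m) ≈ r * s + 1ℤ

    num²≈ zero = begin
      - (r * s + r * r) * - (r * s + r * r) ≡⟨ solve (r ∷ s ∷ []) ⟩
      (r * s + r * r) * (r * s + r * r)     ≈⟨ *-cong r*s+r²≈r*s+1 r*s+r²≈r*s+1 ⟩
      (r * s + 1ℤ) * (r * s + 1ℤ)           ∎
      where
      r*s+r²≈r*s+1 : r * s + r * r ≈ r * s + 1ℤ
      r*s+r²≈r*s+1 = +-cong (≈-refl {r * s}) (square≈1 r 3∤r)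
    num²≈ (suc m) = *-cong (num-suc≈ m) (num-suc≈ m)

    num-suc≈ m = begin
      num m * num m + - (r * s + r * r) * (t (suc m) * t (suc m))
        ≈⟨ +-cong (num²≈ m)
                  (*-cong (≈-refl {x = - (r * s + r * r)}) (*-cong (t-suc≈s m) (t-suc≈s m))) ⟩
      (r * s + 1ℤ) * (r * s + 1ℤ) + - (r * s + r * r) * (s * s)
        ≡⟨ solve (r ∷ s ∷ []) ⟩
      r * s + 1ℤ + r * s - r * (s * (s * s))
        ≈⟨ +-cong (≈-refl {r * s + 1ℤ + r * s}) (neg-cong (*-cong (≈-refl {r}) (cube≈ s))) ⟩
      r * s + 1ℤ + r * s - r * s
        ≡⟨ solve (r ∷ s ∷ []) ⟩
      r * s + 1ℤ ∎

    orbit-minus≈1 : ∀ m → num (suc m) - r * t (suc (suc m)) ≈ 1ℤ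
    orbit-minus≈1 m = begin
      num (suc m) - r * t (suc (suc m))
        ≈⟨ +-cong (num-suc≈ m) (neg-cong (*-cong (≈-refl {r}) (t-suc≈s (suc m)))) ⟩
      r * s + 1ℤ - r * s
        ≡⟨ solve (r ∷ s ∷ []) ⟩
      1ℤ ∎

proposition5p2 : (a : ℚ) → ¬ ((+ 3) ∣ (↥ a)) →
    (n : ℕ) → n ≥ 2 → (+ 3) ∣ ((↥ (iter (fOf a) n 0ℚ -ℚ a)) - + 1)
proposition5p2 a 3∤↥a (suc (suc m)) _ = Signed.∣⇒∣ᵤ (≈⇒∣ (begin
  ↥ (iter (fOf a) (suc (suc m)) 0ℚ -ℚ a) ≡⟨ ↥-orbit-minus (cOf-≃÷ a≃) a≃ κ⊥s (suc m) ⟩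
  num (suc m) - r * t (suc (suc m))      ≈⟨ orbit-minus≈1 r s (3∤↥a ∘ Signed.∣⇒∣ᵤ) m ⟩
  1ℤ                                     ∎))
  where
  open ≈-Reasoning
  r s : ℤ
  r = ↥ a
  s = ↧ a
  open Orbit s (- (r * s + r * r))
  a≃ : a ≃ r ÷ s
  a≃ = fraction (*≡* refl)
  κ⊥s : Comaximal (- (r * s + r * r)) s
  κ⊥s = comaximal-cOf-numerator (comaximal-↥↧ a)
proposition5p2 a 3∤↥a (suc zero) (s≤s ())
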